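{- Let $p$ be a prime, $r$ a positive integer, $d = p^r$, and $f(x) = x(dx - 1) \in \mathbb{Z}[x]$. If $n$ is a power of $p$ (i.e. $n = p^k$ for some integer $k \ge 0$), then $D_f(n) = n$.
   Context: For $f \in \mathbb{Z}[x]$ and $n \in \mathbb{Z}^{+}$, the discriminator $D_f(n)$ is the smallest positive integer $m$ such that $f(1), f(2), \ldots, f(n)$ are pairwise distinct modulo $m$; if no such $m$ exists, $D_f(n) = \infty$. -}

module Defs where

open import Data.Nat as ℕ using (ℕ; suc; _≤_; _<_)
open import Data.Integer as ℤ using (ℤ; +_; _-_; _*_)
open import Data.Integer.Divisibility as ℤD using ()
open import Data.Product using (_×_)
open import Relation.Binary.PropositionalEquality using (_≡_)
open import Relation.Nullary using (¬_)

DistinctMod : (ℤ → ℤ) → ℕ → ℕ → Set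
DistinctMod f n m =
  ∀ i j → 1 ≤ i → i ≤ n → 1 ≤ j → j ≤ n → ¬ (i ≡ j) →
  ¬ ((+ m) ℤD.∣ (f (+ i) - f (+ j)))

Discriminator : (ℤ → ℤ) → ℕ → ℕ → Set
Discriminator f n m =
  1 ≤ m × DistinctMod f n m × (∀ m′ → 1 ≤ m′ → m′ < m → ¬ DistinctMod f n m′)

fpoly : ℕ → ℤ → ℤ
fpoly d x = x * ((+ d) * x - + 1)

{-# OPTIONS --safe #-}
module Submission where

-- Write f(i) - f(j) = (i - j)(d(i + j) - 1). When p ∣ d the second factor is prime to p,
-- so p^k ∣ f(i) - f(j) forces p^k ∣ i - j, impossible for distinct i, j ∈ [1, p^k].
-- Conversely, for any polynomial f and any m < n, f(1 + m) ≡ f(1) modulo m.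

open import Defs
open import Data.Nat using (ℕ; _^_; _≤_)
open import Data.Nat.Primality using (Prime)

open import Data.Nat as ℕ using (zero; suc; _<_; _∸_; z≤n; s≤s; >-nonZero)
open import Data.Nat.Properties
  using (<-cmp; ∸-monoʳ-<; m<n⇒0<n∸m; <-≤-trans; <⇒≤; ≤-refl; m^n>0; *-comm; *-assoc)
open import Data.Nat.Divisibility
  using (_∣_; _∤_; divides; 1∣_; ∣-trans; m∣m*n; >⇒∤; ∣1⇒≡1; *-monoʳ-∣; *-cancelˡ-∣)
open import Data.Nat.Primality using (euclidsLemma; prime⇒nonZero; prime⇒nonTrivial)
open import Data.Integer using (ℤ; +_; -_; _⊖_; ∣_∣; _+_; _-_; _*_)
open import Data.Integer.Properties using ([+m]-[+n]≡m⊖n; ∣m⊖n∣≡∣n⊖m∣; ∣⊖∣-<; abs-*)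
open import Data.Integer.Tactic.RingSolver using (solve-∀)
import Data.Integer.Divisibility as ℤᵘ
import Data.Integer.Divisibility.Signed as ℤˢ
open import Data.Sum using (inj₁; inj₂)
open import Data.Product using (_,_)
open import Relation.Nullary using (¬_; contradiction)
open import Relation.Binary using (tri<; tri≈; tri>)
open import Relation.Binary.PropositionalEquality

fpoly-diff : ∀ d x y → fpoly d x - fpoly d y ≡ (x - y) * (+ d * (x + y) - + 1)
fpoly-diff d = identity (+ d)
  where
  identity : ∀ c x y → x * (c * x - + 1) - y * (c * y - + 1) ≡ (x - y) * (c * (x + y) - + 1)
  identity = solve-∀

sub∣fpoly-diff : ∀ d x y → (x - y) ℤᵘ.∣ (fpoly d x - fpoly d y)
sub∣fpoly-diff d x y = subst (∣ x - y ∣ ∣_)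
  (sym (trans (cong ∣_∣ (fpoly-diff d x y)) (abs-* (x - y) _)))
  (m∣m*n _)

¬DistinctMod-below : ∀ {f} → (∀ x y → (x - y) ℤᵘ.∣ (f x - f y)) →
  ∀ {n m} → 1 ≤ m → m < n → ¬ DistinctMod f n m
¬DistinctMod-below {f} sub∣diff {m = m} (s≤s _) m<n distinct =
  distinct (suc m) 1 (s≤s z≤n) m<n ≤-refl (<-≤-trans (s≤s z≤n) m<n) (λ ()) m∣diff
  where
  m∣diff : (+ m) ℤᵘ.∣ (f (+ suc m) - f (+ 1))
  m∣diff = subst (λ z → z ℤᵘ.∣ (f (+ suc m) - f (+ 1)))
    ([+m]-[+n]≡m⊖n (suc m) 1) (sub∣diff (+ suc m) (+ 1))

prime^∣m*n⇒∣m : ∀ {p n} → Prime p → p ∤ n → ∀ k {m} → p ^ k ∣ m ℕ.* n → p ^ k ∣ m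
prime^∣m*n⇒∣m _ _ zero {m} _ = 1∣ m
prime^∣m*n⇒∣m {p} {n} pp p∤n (suc k) {m} pᵏ⁺¹∣mn
  with euclidsLemma m n pp (∣-trans (m∣m*n (p ^ k)) pᵏ⁺¹∣mn)
... | inj₂ p∣n = contradiction p∣n p∤n
... | inj₁ (divides q refl) =
  subst (p ^ suc k ∣_) (*-comm p q) (*-monoʳ-∣ p (prime^∣m*n⇒∣m pp p∤n k pᵏ∣qn))
  where
  instance _ = prime⇒nonZero pp
  pᵏ∣qn : p ^ k ∣ q ℕ.* n
  pᵏ∣qn = *-cancelˡ-∣ p (subst (p ^ suc k ∣_)
    (trans (cong (ℕ._* n) (*-comm q p)) (*-assoc p q n)) pᵏ⁺¹∣mn)

prime∤pred : ∀ {p} → Prime p → ∀ x → (+ p) ℤᵘ.∣ x → ¬ (+ p) ℤᵘ.∣ (x - + 1)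
prime∤pred {p} pp x p∣x p∣x-1 =
  contradiction (∣1⇒≡1 p∣1) (ℕ.nonTrivial⇒≢1 {{prime⇒nonTrivial pp}})
  where
  p∣-1 : (+ p) ℤˢ.∣ (- + 1)
  p∣-1 = ℤˢ.∣m+n∣m⇒∣n {m = x} (ℤˢ.∣ᵤ⇒∣ p∣x-1) (ℤˢ.∣ᵤ⇒∣ {+ p} {x} p∣x)
  p∣1 : p ∣ 1
  p∣1 = ℤˢ.∣⇒∣ᵤ (ℤˢ.∣m⇒∣-m p∣-1)

<⇒∤∸ : ∀ {n i j} → 1 ≤ i → i < j → j ≤ n → n ∤ j ∸ i
<⇒∤∸ 1≤i i<j j≤n = >⇒∤ {{>-nonZero (m<n⇒0<n∸m i<j)}}
  (<-≤-trans (∸-monoʳ-< 1≤i (<⇒≤ i<j)) j≤n)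

∤∣i⊖j∣ : ∀ {n i j} → 1 ≤ i → i ≤ n → 1 ≤ j → j ≤ n → i ≢ j → n ∤ ∣ i ⊖ j ∣
∤∣i⊖j∣ {i = i} {j} 1≤i i≤n 1≤j j≤n i≢j with <-cmp i j
... | tri≈ _ i≡j _ = contradiction i≡j i≢j
... | tri< i<j _ _ rewrite ∣⊖∣-< i<j = <⇒∤∸ 1≤i i<j j≤n
... | tri> _ _ j<i rewrite ∣m⊖n∣≡∣n⊖m∣ i j | ∣⊖∣-< j<i = <⇒∤∸ 1≤j j<i i≤n

DistinctMod-fpoly : ∀ {p d} → Prime p → p ∣ d → ∀ k → DistinctMod (fpoly d) (p ^ k) (p ^ k)
DistinctMod-fpoly {p} {d} pp p∣d k i j 1≤i i≤n 1≤j j≤n i≢j pᵏ∣diff =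
  ∤∣i⊖j∣ 1≤i i≤n 1≤j j≤n i≢j (subst (p ^ k ∣_) (cong ∣_∣ ([+m]-[+n]≡m⊖n i j)) pᵏ∣i-j)
  where
  p∣d[i+j] : (+ p) ℤᵘ.∣ (+ d * (+ i + + j))
  p∣d[i+j] = ℤˢ.∣⇒∣ᵤ (ℤˢ.∣m⇒∣m*n (+ i + + j) (ℤˢ.∣ᵤ⇒∣ {+ p} {+ d} p∣d))
  c : ℤ
  c = + d * (+ i + + j) - + 1
  p∤c : ¬ (+ p) ℤᵘ.∣ c
  p∤c = prime∤pred pp (+ d * (+ i + + j)) p∣d[i+j]
  pᵏ∣i-j : p ^ k ∣ ∣ + i - + j ∣
  pᵏ∣i-j = prime^∣m*n⇒∣m pp p∤c k (subst (p ^ k ∣_)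
    (trans (cong ∣_∣ (fpoly-diff d (+ i) (+ j))) (abs-* (+ i - + j) c)) pᵏ∣diff)

corollary1 : (p r k : ℕ) → Prime p → 1 ≤ r →
    Discriminator (fpoly (p ^ r)) (p ^ k) (p ^ k)
corollary1 p (suc r) k pp _ =
  m^n>0 p {{prime⇒nonZero pp}} k , DistinctMod-fpoly {d = p ^ suc r} pp p∣pʳ⁺¹ k ,
  λ m 1≤m m<pᵏ → ¬DistinctMod-below {fpoly (p ^ suc r)} (sub∣fpoly-diff (p ^ suc r)) 1≤m m<pᵏ
  where
  p∣pʳ⁺¹ : p ∣ p ^ suc r
  p∣pʳ⁺¹ = m∣m*n (p ^ r)
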